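{- Let $k$ be a positive integer and let $\vec{i_1},\dots,\vec{i_k}\in\mathbb{N}^k$ be $k$ distinct points. Then there is some $d\in[k]$ such that the points $\vec{i_1}/d,\dots,\vec{i_k}/d$ are pairwise distinct.
   Context: For $\vec{i}\in\mathbb{N}^k$ and $d\in[k]$, $\vec{i}/d\in\mathbb{N}^{k-1}$ denotes $\vec{i}$ with its $d$-th coordinate deleted. -}

module Defs where

open import Data.Nat using (ℕ; suc)
open import Data.Fin using (Fin)
open import Data.Vec using (Vec; removeAt)

_/ᵖ_ : ∀ {n} → Vec ℕ (suc n) → Fin (suc n) → Vec ℕ n
i /ᵖ d = removeAt i d

{-# OPTIONS --safe #-}
-- Call two points of Aᵏ an edge labelled d when they differ exactly in
-- coordinate d.  If deleting coordinate d is not injective on the given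
-- points, two of them form an edge labelled d; so if no deletion were
-- injective, k points would carry k edges with pairwise distinct labels.
-- Such edge sets are forests: splitting the points by the d-th coordinate
-- of one edge labelled d separates its endpoints and keeps every other edge
-- inside one part, so by induction there are fewer edges than points.
module Submission where

open import Defs
open import Data.Nat using (ℕ; suc; _+_; _<_; s≤s; _≟_)
open import Data.Nat.Induction using (<-wellFounded)
open import Data.Nat.Properties using (+-suc; +-mono-≤; n≮n; module ≤-Reasoning)
open import Data.Fin using (Fin; zero; punchOut) renaming (_≟_ to _≟ᶠ_)
open import Data.Fin.Properties using (any?; all?; ¬∀⟶∃¬)
open import Data.Vec using (Vec; lookup; removeAt)
open import Data.Vec.Properties using (removeAt-punchOut; ≡-dec)
open import Data.Vec.Relation.Binary.Pointwise.Extensional using (ext; Pointwise-≡⇒≡)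
open import Data.List using (List; []; _∷_; length; filter; tabulate)
open import Data.List.Properties using (length-filter; length-tabulate)
open import Data.List.Membership.Propositional using (_∈_)
open import Data.List.Membership.Propositional.Properties using (∈-filter⁺; ∈-tabulate⁺; ∈-length)
open import Data.List.Relation.Unary.All using (All; []; _∷_)
import Data.List.Relation.Unary.All.Properties as All
open import Data.List.Relation.Unary.AllPairs using (AllPairs; []; _∷_)
import Data.List.Relation.Unary.AllPairs.Properties as AllPairs
open import Data.Product using (∃-syntax; _×_; _,_; map₂)
open import Data.Empty using (⊥-elim)
open import Function using (_∘_; id; case_of_)
open import Function.Definitions using (Injective)
open import Induction.WellFounded using (Acc; acc)
open import Level using (0ℓ)
open import Relation.Binary.Definitions using (DecidableEquality)
open import Relation.Binary.PropositionalEquality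
  using (_≡_; _≢_; refl; sym; cong; subst; subst₂; ≢-sym; module ≡-Reasoning)
open import Relation.Nullary using (¬_; Dec; yes; no; ¬?)
open import Relation.Nullary.Decidable using (_×-dec_; decidable-stable)
open import Relation.Unary using (Pred; Decidable)
open import Relation.Unary.Properties using (∁?)

length-filter+length-filter-∁ : ∀ {A : Set} {P : Pred A 0ℓ} (P? : Decidable P) xs →
                                length (filter P? xs) + length (filter (∁? P?) xs) ≡ length xs
length-filter+length-filter-∁ P? [] = refl
length-filter+length-filter-∁ P? (x ∷ xs) with P? x
... | yes _ = cong suc (length-filter+length-filter-∁ P? xs)
... | no  _ = begin
  length (filter P? xs) + suc (length (filter (∁? P?) xs)) ≡⟨ +-suc _ _ ⟩
  suc (length (filter P? xs) + length (filter (∁? P?) xs))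
    ≡⟨ cong suc (length-filter+length-filter-∁ P? xs) ⟩
  suc (length xs)                                           ∎
  where open ≡-Reasoning

record Edge (A : Set) (k : ℕ) : Set where
  field
    label    : Fin k
    src tgt  : Vec A k
    src≢tgt  : lookup src label ≢ lookup tgt label
    agree    : ∀ j → j ≢ label → lookup src j ≡ lookup tgt j

open Edge

module _ {A : Set} {k : ℕ} where

  EdgeIn : List (Vec A k) → Edge A k → Set
  EdgeIn xs e = src e ∈ xs × tgt e ∈ xs

  DistinctLabels : List (Edge A k) → Set
  DistinctLabels = AllPairs (λ e f → label e ≢ label f)

  module Class {Q : Pred A 0ℓ} (Q? : Decidable Q) (c : Fin k) where

    member? : Decidable (λ (x : Vec A k) → Q (lookup x c))
    member? x = Q? (lookup x c)

    srcMember? : Decidable (λ (e : Edge A k) → Q (lookup (src e) c))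
    srcMember? e = member? (src e)

    edgeIn-class : ∀ {xs e} → c ≢ label e → EdgeIn xs e → Q (lookup (src e) c) →
                   EdgeIn (filter member? xs) e
    edgeIn-class {e = e} c≢l (s∈ , t∈) q =
      ∈-filter⁺ member? s∈ q , ∈-filter⁺ member? t∈ (subst Q (agree e c c≢l) q)

    edgesIn-class : ∀ {xs es} → All (λ e → c ≢ label e) es → All (EdgeIn xs) es →
                    All (EdgeIn (filter member? xs)) (filter srcMember? es)
    edgesIn-class [] [] = []
    edgesIn-class {xs} {e ∷ _} (c≢l ∷ c≢ls) (e∈ ∷ es∈) with srcMember? e
    ... | yes q = edgeIn-class {xs} {e} c≢l e∈ q ∷ edgesIn-class c≢ls es∈
    ... | no  _ = edgesIn-class c≢ls es∈

  edges<points : DecidableEquality A → ∀ {x} xs (es : List (Edge A k)) → x ∈ xs →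
                 All (EdgeIn xs) es → DistinctLabels es → length es < length xs
  edges<points _≟ᴬ_ xs es = go xs es (<-wellFounded (length es))
    where
    go : ∀ {x} xs (es : List (Edge A k)) → Acc _<_ (length es) → x ∈ xs →
         All (EdgeIn xs) es → DistinctLabels es → length es < length xs
    go xs []       _         x∈xs _ _ = ∈-length x∈xs
    go xs (e ∷ es) (acc rec) _ ((s∈ , t∈) ∷ es∈) (c≢ls ∷ distinct) = begin
      suc (suc (length es))               ≡⟨ cong (suc ∘ suc) (length-filter+length-filter-∁ _ es) ⟨
      suc (suc (length es₁ + length es₂)) ≡⟨ +-suc (suc (length es₁)) (length es₂) ⟨
      suc (length es₁) + suc (length es₂) ≤⟨ +-mono-≤ (part Same? src∈) (part Diff? tgt∈) ⟩
      length xs₁ + length xs₂             ≡⟨ length-filter+length-filter-∁ _ xs ⟩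
      length xs                           ∎
      where
      open ≤-Reasoning
      c = label e
      v = lookup (src e) c
      Same? = _≟ᴬ v
      Diff? = ∁? Same?
      module Same = Class Same? c
      module Diff = Class Diff? c
      xs₁ = filter Same.member? xs
      xs₂ = filter Diff.member? xs
      es₁ = filter Same.srcMember? es
      es₂ = filter Diff.srcMember? es

      src∈ : src e ∈ xs₁
      src∈ = ∈-filter⁺ Same.member? s∈ refl

      tgt∈ : tgt e ∈ xs₂
      tgt∈ = ∈-filter⁺ Diff.member? t∈ (src≢tgt e ∘ sym)

      part : ∀ {Q} (Q? : Decidable Q) {y} → let open Class Q? c in
             y ∈ filter member? xs → length (filter srcMember? es) < length (filter member? xs)
      part Q? y∈ = go _ _ (rec (s≤s (length-filter srcMember? es))) y∈
                     (edgesIn-class c≢ls es∈) (AllPairs.filter⁺ srcMember? distinct)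
        where open Class Q? c

module _ {A : Set} where

  removeAt-≡⇒agree : ∀ {n} {x y : Vec A (suc n)} d → removeAt x d ≡ removeAt y d →
                     ∀ j → j ≢ d → lookup x j ≡ lookup y j
  removeAt-≡⇒agree {x = x} {y} d eq j j≢d = begin
    lookup x j                           ≡⟨ removeAt-punchOut x d≢j ⟨
    lookup (removeAt x d) (punchOut d≢j) ≡⟨ cong (λ z → lookup z (punchOut d≢j)) eq ⟩
    lookup (removeAt y d) (punchOut d≢j) ≡⟨ removeAt-punchOut y d≢j ⟩
    lookup y j                           ∎
    where
    open ≡-Reasoning
    d≢j = ≢-sym j≢d

  agree-except⇒≢-at : ∀ {k} {x y : Vec A k} d → (∀ j → j ≢ d → lookup x j ≡ lookup y j) →
                      x ≢ y → lookup x d ≢ lookup y d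
  agree-except⇒≢-at {x = x} {y} d agree x≢y xd≡yd = x≢y (Pointwise-≡⇒≡ (ext pointwise))
    where
    pointwise : ∀ j → lookup x j ≡ lookup y j
    pointwise j with j ≟ᶠ d
    ... | yes refl = xd≡yd
    ... | no  j≢d  = agree j j≢d

  removeAt-collision⇒edge : ∀ {n} {x y : Vec A (suc n)} d → x ≢ y → removeAt x d ≡ removeAt y d →
                            Edge A (suc n)
  removeAt-collision⇒edge {x = x} {y} d x≢y eq = record
    { label   = d
    ; src     = x
    ; tgt     = y
    ; src≢tgt = agree-except⇒≢-at d agreement x≢y
    ; agree   = agreement
    }
    where agreement = removeAt-≡⇒agree {x = x} {y} d eq

module _ {B : Set} {m : ℕ} where

  Collision : (Fin m → B) → Set
  Collision f = ∃[ i ] ∃[ j ] (i ≢ j × f i ≡ f j)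

  collision? : DecidableEquality B → (f : Fin m → B) → Dec (Collision f)
  collision? _≟ᴮ_ f = any? λ i → any? λ j → ¬? (i ≟ᶠ j) ×-dec (f i ≟ᴮ f j)

  ¬collision⇒injective : ∀ {f : Fin m → B} → ¬ Collision f → Injective _≡_ _≡_ f
  ¬collision⇒injective none {i} {j} fi≡fj =
    decidable-stable (i ≟ᶠ j) (λ i≢j → none (i , j , i≢j , fi≡fj))

¬every-removeAt-collides : ∀ {A : Set} {n} → DecidableEquality A →
                           (pts : Fin (suc n) → Vec A (suc n)) → Injective _≡_ _≡_ pts →
                           ¬ (∀ d → Collision (λ j → removeAt (pts j) d))
¬every-removeAt-collides {A} {n} _≟ᴬ_ pts pts-inj collides =
  n≮n (suc n) (subst₂ _<_ (length-tabulate edgeAt) (length-tabulate pts) bound)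
  where
  edgeAt : Fin (suc n) → Edge A (suc n)
  edgeAt d = let (i , j , i≢j , eq) = collides d
             in  removeAt-collision⇒edge {x = pts i} {pts j} d (i≢j ∘ pts-inj) eq

  edgeIn : ∀ d → EdgeIn (tabulate pts) (edgeAt d)
  edgeIn d = let (i , j , _) = collides d in ∈-tabulate⁺ {f = pts} i , ∈-tabulate⁺ {f = pts} j

  bound : length (tabulate edgeAt) < length (tabulate pts)
  bound = edges<points _≟ᴬ_ (tabulate pts) (tabulate edgeAt) (∈-tabulate⁺ {f = pts} zero)
            (All.tabulate⁺ {f = edgeAt} edgeIn) (AllPairs.tabulate⁺ {f = edgeAt} id)

lemma27 : (n : ℕ) (pts : Fin (suc n) → Vec ℕ (suc n))
          → Injective _≡_ _≡_ pts
          → ∃[ d ] Injective _≡_ _≡_ (λ j → pts j /ᵖ d)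
lemma27 n pts pts-inj = case all? collides? of λ where
    (yes collide) → ⊥-elim (¬every-removeAt-collides _≟_ pts pts-inj collide)
    (no ¬collide) → map₂ ¬collision⇒injective (¬∀⟶∃¬ _ _ collides? ¬collide)
  where
  collides? : Decidable (λ d → Collision (λ j → pts j /ᵖ d))
  collides? d = collision? (≡-dec _≟_) (λ j → pts j /ᵖ d)
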